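{- Let $n$ be a positive integer and let $i$ be an integer with $1\le i\le\lceil n/2\rceil$. For every integer $t\le n^2/4$ with $t\equiv n-i\pmod 2$ and $\Pr_{w\sim\mathcal{W}(i)}[\min_{0\le r\le t}w^{(r)}<1]>0$, \[ \Pr_{w\sim\mathcal{W}(i)}\Big[w^{(t)}=n,\ \max_{0\le r\le t}w^{(r)}=n\Big]\ \ge\ \Pr_{w\sim\mathcal{W}(i)}\Big[w^{(t)}=n,\ \max_{0\le r\le t}w^{(r)}=n\ \Big|\ \min_{0\le r\le t}w^{(r)}<1\Big]. \]
   Context: $\mathcal{W}(i)$ denotes a simple symmetric random walk $(w^{(0)},w^{(1)},\dots)$ on $\mathbb{Z}$ with $w^{(0)}=i$ and independent $\pm1$ steps, each with probability $1/2$. -}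

module Defs where

open import Data.Bool using (Bool; true; false; _∧_)
open import Data.Nat as ℕ using (ℕ; zero; suc; _^_)
open import Data.Nat.Properties using (m^n≢0)
open import Data.List using (List; []; _∷_; map; _++_; filterᵇ; length)
open import Data.Integer as ℤ using (ℤ; +_; _⊔_; _⊓_)
open import Data.Rational as ℚ using (ℚ; 0ℚ)
open import Relation.Nullary.Decidable using (⌊_⌋)

-- A path of the walk with t steps: a list of t steps, true = +1, false = -1.
-- Every such list has probability 2^-t under the simple symmetric random walk.
step : Bool → ℤ → ℤ
step true  x = x ℤ.+ + 1
step false x = x ℤ.- + 1

allPaths : ℕ → List (List Bool)
allPaths zero    = [] ∷ []
allPaths (suc t) = map (true ∷_) (allPaths t) ++ map (false ∷_) (allPaths t)

endW : ℤ → List Bool → ℤ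
endW x []       = x
endW x (b ∷ bs) = endW (step b x) bs

maxW : ℤ → List Bool → ℤ
maxW x []       = x
maxW x (b ∷ bs) = x ⊔ maxW (step b x) bs

minW : ℤ → List Bool → ℤ
minW x []       = x
minW x (b ∷ bs) = x ⊓ minW (step b x) bs

Event : Set
Event = List Bool → Bool

count : ℕ → Event → ℕ
count t A = length (filterᵇ A (allPaths t))

Pr : ℕ → Event → ℚ
Pr t A = (+ count t A) ℚ./ (2 ^ t)
  where instance _ = m^n≢0 2 t

-- conditional probability Pr[A | B] = #(A ∩ B) / #B (uniform measure on paths);
-- set to 0 when Pr[B] = 0 (never used: the theorem assumes Pr[B] > 0)
CondPr : ℕ → Event → Event → ℚ
CondPr t A B with count t B
... | zero  = 0ℚ
... | suc k = (+ count t (λ p → A p ∧ B p)) ℚ./ suc k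

hitsTopAtEnd : ℤ → ℕ → Event
hitsTopAtEnd i n p = ⌊ endW i p ℤ.≟ + n ⌋ ∧ ⌊ maxW i p ℤ.≟ + n ⌋

goesBelow1 : ℤ → Event
goesBelow1 i p = ⌊ minW i p ℤ.<? + 1 ⌋

-- Let A be the event that the walk from i ends at its running maximum n, and B the event that it
-- drops below 1; the claim is Pr[A ∩ B] ≤ Pr[A] Pr[B]. Split B at the first visit to 0: arriving
-- there with s steps left forces s ≤ t − i, and from 0 the walk lies in A with probability
-- ballot n s / 2^s, where ballot d u counts u-step walks reaching a ceiling d above their start
-- without crossing it. So it suffices that ballot n s / 2^s ≤ ballot (n − i) t / 2^t = Pr[A].
-- Writing p d u = ballot d u / 2^u, the closed form ballot d (d + 2m) = (d+1)/(d+m+1) · (d+2m choose m)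
-- shows that, while u stays below about n²/4, p n u ≤ p n (u + 2) and p (d + 1) u ≤ p d (u + 1).
-- Since t ≡ n − i (mod 2), (t − i − s)/2 uses of the first and i of the second (2i ≤ n + 1 keeps d
-- large enough) carry p n s to p (n − i) t.
module Submission where

open import Defs
open import Data.Bool using (Bool; true; false; _∧_)
open import Data.Bool.Properties using (∧-zeroʳ; ∧-identityʳ)
open import Data.Empty using (⊥-elim)
open import Data.Integer as ℤ using (ℤ; +_; +≤+; +<+)
import Data.Integer.Properties as ℤₚ
import Data.Integer.Tactic.RingSolver as ℤ-Solver
open import Data.List using (List; []; _∷_; map; _++_; filterᵇ; length)
import Data.List.Properties as List
open import Data.Nat as ℕ using (ℕ; zero; suc; _+_; _*_; _∸_; _^_; _≤_; _%_; ⌈_/2⌉; _!; z≤n; s≤s)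
open import Data.Nat.DivMod using ([m+kn]%n≡m%n)
open import Data.Nat.Properties
open import Data.Nat.Tactic.RingSolver using (solve-∀)
open import Data.Product using (∃; _,_)
import Data.Rational as ℚ
open import Data.Rational using (0ℚ; _<_; _≥_)
import Data.Rational.Properties as ℚₚ
import Data.Rational.Unnormalised as ℚᵘ
import Data.Rational.Unnormalised.Properties as ℚᵘₚ
open import Data.Sum using (_⊎_; inj₁; inj₂)
open import Relation.Binary.PropositionalEquality
open import Relation.Nullary using (Dec; yes; no; ¬_)
open import Relation.Nullary.Decidable using (⌊_⌋; isYes≗does; dec-true; dec-false)

-- Counting paths by their first step

length-filterᵇ-map : ∀ (E : Event) (f : List Bool → List Bool) xs →
  length (filterᵇ E (map f xs)) ≡ length (filterᵇ (λ p → E (f p)) xs)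
length-filterᵇ-map E f []       = refl
length-filterᵇ-map E f (x ∷ xs) with E (f x)
... | true  = cong suc (length-filterᵇ-map E f xs)
... | false = length-filterᵇ-map E f xs

count-suc : ∀ t E →
  count (suc t) E ≡ count t (λ p → E (true ∷ p)) + count t (λ p → E (false ∷ p))
count-suc t E = begin
  length (filterᵇ E (map (true ∷_) paths ++ map (false ∷_) paths))
    ≡⟨ cong length (List.filter-++ _ (map (true ∷_) paths) _) ⟩
  length (filterᵇ E (map (true ∷_) paths) ++ filterᵇ E (map (false ∷_) paths))
    ≡⟨ List.length-++ (filterᵇ E (map (true ∷_) paths)) ⟩
  length (filterᵇ E (map (true ∷_) paths)) + length (filterᵇ E (map (false ∷_) paths))
    ≡⟨ cong₂ _+_ (length-filterᵇ-map E (true ∷_) paths) (length-filterᵇ-map E (false ∷_) paths) ⟩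
  count t (λ p → E (true ∷ p)) + count t (λ p → E (false ∷ p)) ∎
  where
  open ≡-Reasoning
  paths = allPaths t

count-cong : ∀ t {E E′ : Event} → (∀ p → E p ≡ E′ p) → count t E ≡ count t E′
count-cong zero {E} {E′} E≗E′ with E [] | E′ [] | E≗E′ []
... | true  | .true  | refl = refl
... | false | .false | refl = refl
count-cong (suc t) {E} {E′} E≗E′ = begin
  count (suc t) E                                               ≡⟨ count-suc t E ⟩
  count t (λ p → E (true ∷ p)) + count t (λ p → E (false ∷ p))
    ≡⟨ cong₂ _+_ (count-cong t (λ p → E≗E′ (true ∷ p))) (count-cong t (λ p → E≗E′ (false ∷ p))) ⟩
  count t (λ p → E′ (true ∷ p)) + count t (λ p → E′ (false ∷ p)) ≡⟨ count-suc t E′ ⟨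
  count (suc t) E′                                              ∎
  where open ≡-Reasoning

count-none : ∀ t {E : Event} → (∀ p → E p ≡ false) → count t E ≡ 0
count-none zero    E≡false rewrite E≡false [] = refl
count-none (suc t) {E} E≡false
  rewrite count-suc t E
        | count-none t (λ p → E≡false (true ∷ p))
        | count-none t (λ p → E≡false (false ∷ p)) = refl

count-all : ∀ t {E : Event} → (∀ p → E p ≡ true) → count t E ≡ 2 ^ t
count-all zero    E≡true rewrite E≡true [] = refl
count-all (suc t) {E} E≡true
  rewrite count-suc t E
        | count-all t (λ p → E≡true (true ∷ p))
        | count-all t (λ p → E≡true (false ∷ p))
        | +-identityʳ (2 ^ t) = refl

⌊⌋-true : ∀ {a} {A : Set a} (a? : Dec A) → A → ⌊ a? ⌋ ≡ true
⌊⌋-true a? a = trans (isYes≗does a?) (dec-true a? a)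

⌊⌋-false : ∀ {a} {A : Set a} (a? : Dec A) → ¬ A → ⌊ a? ⌋ ≡ false
⌊⌋-false a? ¬a = trans (isYes≗does a?) (dec-false a? ¬a)

start≤maxW : ∀ x p → x ℤ.≤ maxW x p
start≤maxW x []      = ℤₚ.≤-refl
start≤maxW x (b ∷ p) = ℤₚ.i≤i⊔j x _

endW≤maxW : ∀ x p → endW x p ℤ.≤ maxW x p
endW≤maxW x []      = ℤₚ.≤-refl
endW≤maxW x (b ∷ p) = ℤₚ.≤-trans (endW≤maxW (step b x) p) (ℤₚ.i≤j⊔i x _)

minW≤start : ∀ x p → minW x p ℤ.≤ x
minW≤start x []      = ℤₚ.≤-refl
minW≤start x (b ∷ p) = ℤₚ.i⊓j≤i x _

hitsTopAtEnd-∷ : ∀ n x b p → x ℤ.≤ + n →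
  hitsTopAtEnd x n (b ∷ p) ≡ hitsTopAtEnd (step b x) n p
hitsTopAtEnd-∷ n x b p x≤n with endW (step b x) p ℤ.≟ + n
... | no  _   = refl
... | yes end≡n rewrite ℤₚ.i≤j⇒i⊔j≡j (ℤₚ.≤-trans x≤n (subst (ℤ._≤ maxW (step b x) p) end≡n (endW≤maxW (step b x) p))) = refl

hitsTopAtEnd-above : ∀ n x p → + n ℤ.< x → hitsTopAtEnd x n p ≡ false
hitsTopAtEnd-above n x p n<x =
  trans (cong (⌊ endW x p ℤ.≟ + n ⌋ ∧_) (⌊⌋-false (maxW x p ℤ.≟ + n) max≢n)) (∧-zeroʳ _)
  where
  max≢n : maxW x p ≢ + n
  max≢n max≡n = ℤₚ.<-irrefl (sym max≡n) (ℤₚ.<-≤-trans n<x (start≤maxW x p))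

goesBelow1-below : ∀ x p → x ℤ.< + 1 → goesBelow1 x p ≡ true
goesBelow1-below x p x<1 = ⌊⌋-true (minW x p ℤ.<? + 1) (ℤₚ.≤-<-trans (minW≤start x p) x<1)

goesBelow1-[] : ∀ x → + 1 ℤ.≤ x → goesBelow1 x [] ≡ false
goesBelow1-[] x 1≤x = ⌊⌋-false (x ℤ.<? + 1) (ℤₚ.≤⇒≯ 1≤x)

goesBelow1-∷ : ∀ x b p → + 1 ℤ.≤ x → goesBelow1 x (b ∷ p) ≡ goesBelow1 (step b x) p
goesBelow1-∷ x b p 1≤x with ℤₚ.≤-total x (minW (step b x) p)
... | inj₂ min≤x rewrite ℤₚ.i≥j⇒i⊓j≡j min≤x = refl
... | inj₁ x≤min rewrite ℤₚ.i≤j⇒i⊓j≡i x≤min =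
  trans (⌊⌋-false (x ℤ.<? + 1) (ℤₚ.≤⇒≯ 1≤x))
        (sym (⌊⌋-false (minW (step b x) p ℤ.<? + 1) (ℤₚ.≤⇒≯ (ℤₚ.≤-trans 1≤x x≤min))))

i<i+[1+n] : ∀ x d → x ℤ.< x ℤ.+ + suc d
i<i+[1+n] x d = subst (ℤ._< x ℤ.+ + suc d) (ℤₚ.+-identityʳ x) (ℤₚ.+-monoʳ-< x (+<+ (s≤s z≤n)))

step-true-+ : ∀ x d → step true x ℤ.+ + d ≡ x ℤ.+ + suc d
step-true-+ x d = ℤₚ.+-assoc x (+ 1) (+ d)

step-false-+ : ∀ x d → step false x ℤ.+ + suc d ≡ x ℤ.+ + d
step-false-+ x d = lemma x (+ d)
  where
  lemma : ∀ x y → (x ℤ.- ℤ.1ℤ) ℤ.+ (ℤ.1ℤ ℤ.+ y) ≡ x ℤ.+ y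
  lemma = ℤ-Solver.solve-∀

count-split : ∀ u {E Eᵗ Eᶠ : Event} →
  (∀ p → E (true ∷ p) ≡ Eᵗ p) → (∀ p → E (false ∷ p) ≡ Eᶠ p) →
  count (suc u) E ≡ count u Eᵗ + count u Eᶠ
count-split u {E} Eᵗ≗ Eᶠ≗ =
  trans (count-suc u E) (cong₂ _+_ (count-cong u Eᵗ≗) (count-cong u Eᶠ≗))

hitsTopAfterBelow1 : ℤ → ℕ → Event
hitsTopAfterBelow1 x n p = hitsTopAtEnd x n p ∧ goesBelow1 x p

count-hitsTopAtEnd-suc : ∀ n x u → x ℤ.≤ + n →
  count (suc u) (hitsTopAtEnd x n) ≡
  count u (hitsTopAtEnd (step true x) n) + count u (hitsTopAtEnd (step false x) n)
count-hitsTopAtEnd-suc n x u x≤n =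
  count-split u (λ p → hitsTopAtEnd-∷ n x true p x≤n) (λ p → hitsTopAtEnd-∷ n x false p x≤n)

count-hitsTopAtEnd-above : ∀ n x u → + n ℤ.< x → count u (hitsTopAtEnd x n) ≡ 0
count-hitsTopAtEnd-above n x u n<x = count-none u (λ p → hitsTopAtEnd-above n x p n<x)

count-goesBelow1-suc : ∀ x u → + 1 ℤ.≤ x →
  count (suc u) (goesBelow1 x) ≡ count u (goesBelow1 (step true x)) + count u (goesBelow1 (step false x))
count-goesBelow1-suc x u 1≤x =
  count-split u (λ p → goesBelow1-∷ x true p 1≤x) (λ p → goesBelow1-∷ x false p 1≤x)

count-goesBelow1-below : ∀ x u → x ℤ.< + 1 → count u (goesBelow1 x) ≡ 2 ^ u
count-goesBelow1-below x u x<1 = count-all u (λ p → goesBelow1-below x p x<1)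

count-hitsTopAfterBelow1-suc : ∀ n x u → + 1 ℤ.≤ x → x ℤ.≤ + n →
  count (suc u) (hitsTopAfterBelow1 x n) ≡
  count u (hitsTopAfterBelow1 (step true x) n) + count u (hitsTopAfterBelow1 (step false x) n)
count-hitsTopAfterBelow1-suc n x u 1≤x x≤n = count-split u (first-step true) (first-step false)
  where
  first-step : ∀ b p → hitsTopAfterBelow1 x n (b ∷ p) ≡ hitsTopAfterBelow1 (step b x) n p
  first-step b p = cong₂ _∧_ (hitsTopAtEnd-∷ n x b p x≤n) (goesBelow1-∷ x b p 1≤x)

count-hitsTopAfterBelow1-zero : ∀ n x → + 1 ℤ.≤ x → count 0 (hitsTopAfterBelow1 x n) ≡ 0
count-hitsTopAfterBelow1-zero n x 1≤x
  rewrite goesBelow1-[] x 1≤x | ∧-zeroʳ (hitsTopAtEnd x n []) = refl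

count-hitsTopAfterBelow1-above : ∀ n x u → + n ℤ.< x → count u (hitsTopAfterBelow1 x n) ≡ 0
count-hitsTopAfterBelow1-above n x u n<x =
  count-none u (λ p → cong (_∧ goesBelow1 x p) (hitsTopAtEnd-above n x p n<x))

count-hitsTopAfterBelow1-below : ∀ n x u → x ℤ.< + 1 →
  count u (hitsTopAfterBelow1 x n) ≡ count u (hitsTopAtEnd x n)
count-hitsTopAfterBelow1-below n x u x<1 =
  count-cong u (λ p → trans (cong (hitsTopAtEnd x n p ∧_) (goesBelow1-below x p x<1)) (∧-identityʳ _))

-- Ballot numbers

-- ballot d u is the number of u-step walks that end d above their start without ever going higher.
ballot : ℕ → ℕ → ℕ
ballot zero    zero    = 1
ballot (suc d) zero    = 0
ballot zero    (suc u) = ballot 1 u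
ballot (suc d) (suc u) = ballot d u + ballot (suc (suc d)) u

count-hitsTopAtEnd≡ballot : ∀ n d u x → x ℤ.+ + d ≡ + n → count u (hitsTopAtEnd x n) ≡ ballot d u
count-hitsTopAtEnd≡ballot n zero zero x x+0≡n with trans (sym (ℤₚ.+-identityʳ x)) x+0≡n
... | refl rewrite ⌊⌋-true (+ n ℤ.≟ + n) refl = refl
count-hitsTopAtEnd≡ballot n (suc d) zero x x+d≡n
  rewrite ⌊⌋-false (x ℤ.≟ + n) (λ x≡n → ℤₚ.<-irrefl x≡n (subst (x ℤ.<_) x+d≡n (i<i+[1+n] x d))) = refl
count-hitsTopAtEnd≡ballot n zero (suc u) x x+0≡n with trans (sym (ℤₚ.+-identityʳ x)) x+0≡n
... | refl = begin
  count (suc u) (hitsTopAtEnd (+ n) n)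
    ≡⟨ count-hitsTopAtEnd-suc n (+ n) u ℤₚ.≤-refl ⟩
  count u (hitsTopAtEnd (step true (+ n)) n) + count u (hitsTopAtEnd (step false (+ n)) n)
    ≡⟨ cong₂ _+_ (count-hitsTopAtEnd-above n _ u (i<i+[1+n] (+ n) 0))
                 (count-hitsTopAtEnd≡ballot n 1 u _ (trans (step-false-+ (+ n) 0) (ℤₚ.+-identityʳ (+ n)))) ⟩
  ballot 1 u ∎
  where open ≡-Reasoning
count-hitsTopAtEnd≡ballot n (suc d) (suc u) x x+d≡n = begin
  count (suc u) (hitsTopAtEnd x n)
    ≡⟨ count-hitsTopAtEnd-suc n x u (ℤₚ.<⇒≤ (subst (x ℤ.<_) x+d≡n (i<i+[1+n] x d))) ⟩
  count u (hitsTopAtEnd (step true x) n) + count u (hitsTopAtEnd (step false x) n)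
    ≡⟨ cong₂ _+_ (count-hitsTopAtEnd≡ballot n d u _ (trans (step-true-+ x d) x+d≡n))
                 (count-hitsTopAtEnd≡ballot n (suc (suc d)) u _ (trans (step-false-+ x (suc d)) x+d≡n)) ⟩
  ballot d u + ballot (suc (suc d)) u ∎
  where open ≡-Reasoning

ballot-early : ∀ d u → u ℕ.< d → ballot d u ≡ 0
ballot-early (suc d) zero    _          = refl
ballot-early (suc d) (suc u) (s≤s u<d) =
  cong₂ _+_ (ballot-early d u u<d) (ballot-early (suc (suc d)) u (m<n⇒m<1+n (m<n⇒m<1+n u<d)))

ballot-odd : ∀ m d → ballot d (d + suc (m + m)) ≡ 0
ballot-odd zero    zero    = refl
ballot-odd (suc m) zero    = trans (cong (λ k → ballot 1 (suc k)) (+-suc m m)) (ballot-odd m 1)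
ballot-odd zero    (suc d) =
  cong₂ _+_ (ballot-odd zero d) (ballot-early (suc (suc d)) (d + 1) (subst (ℕ._< 2 + d) (+-comm 1 d) ≤-refl))
ballot-odd (suc m) (suc d) =
  cong₂ _+_ (ballot-odd (suc m) d) (trans (cong (ballot (suc (suc d))) (index d m)) (ballot-odd m (suc (suc d))))
  where
  index : ∀ d m → d + suc (suc (m + suc m)) ≡ suc (suc d) + suc (m + m)
  index = solve-∀

evenBallot : ℕ → ℕ → ℕ
evenBallot d m = ballot d (d + (m + m))

evenBallot-zero : ∀ d → evenBallot d 0 ≡ 1
evenBallot-zero zero    = refl
evenBallot-zero (suc d) =
  cong₂ _+_ (evenBallot-zero d) (ballot-early (suc (suc d)) (d + 0) (s≤s (m≤n⇒m≤1+n (≤-reflexive (+-identityʳ d)))))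

evenBallot-suc : ∀ d m → evenBallot (suc d) (suc m) ≡ evenBallot d (suc m) + evenBallot (suc (suc d)) m
evenBallot-suc d m = cong (λ k → evenBallot d (suc m) + k) (cong (ballot (suc (suc d))) (index d m))
  where
  index : ∀ d m → d + (suc m + suc m) ≡ suc (suc d) + (m + m)
  index = solve-∀

evenBallot-zero-suc : ∀ m → evenBallot 0 (suc m) ≡ evenBallot 1 m
evenBallot-zero-suc m = cong (ballot 1) (+-suc m m)

half : ∀ w → ∃ λ m → w ≡ m + m ⊎ w ≡ suc (m + m)
half zero    = 0 , inj₁ refl
half (suc w) with half w
... | m , inj₁ w≡2m   = m , inj₂ (cong suc w≡2m)
... | m , inj₂ w≡2m+1 = suc m , inj₁ (trans (cong suc w≡2m+1) (cong suc (sym (+-suc m m))))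

ballot≡0⊎even : ∀ d u → ballot d u ≡ 0 ⊎ ∃ λ m → u ≡ d + (m + m)
ballot≡0⊎even d u with u ℕ.<? d
... | yes u<d = inj₁ (ballot-early d u u<d)
... | no u≮d with half (u ∸ d) | m+[n∸m]≡n (≮⇒≥ u≮d)
...   | m , inj₁ u-d≡2m   | d+[u-d]≡u = inj₂ (m , trans (sym d+[u-d]≡u) (cong (_+_ d) u-d≡2m))
...   | m , inj₂ u-d≡2m+1 | d+[u-d]≡u =
  inj₁ (trans (cong (ballot d) (trans (sym d+[u-d]≡u) (cong (_+_ d) u-d≡2m+1))) (ballot-odd m d))

-- The closed form of ballot numbers

-- binom a c is the binomial coefficient (a + c choose a), indexed by both parts so that
-- Pascal's rule involves no truncated subtraction.
binom : ℕ → ℕ → ℕ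
binom zero    c       = 1
binom (suc a) zero    = 1
binom (suc a) (suc c) = binom a (suc c) + binom (suc a) c

binom-factorial : ∀ a c → binom a c * (a ! * c !) ≡ (a + c) !
binom-factorial zero    c       = trans (*-identityˡ _) (*-identityˡ (c !))
binom-factorial (suc a) zero    = trans (*-identityˡ _) (trans (*-identityʳ _) (cong _! (sym (+-identityʳ (suc a)))))
binom-factorial (suc a) (suc c) = begin
  (binom a (suc c) + binom (suc a) c) * ((suc a * a !) * (suc c * c !))
    ≡⟨ distribute a c (binom a (suc c)) (binom (suc a) c) (a !) (c !) ⟩
  suc a * (binom a (suc c) * (a ! * (suc c * c !))) + suc c * (binom (suc a) c * ((suc a * a !) * c !))
    ≡⟨ cong₂ (λ x y → suc a * x + suc c * y)
             (binom-factorial a (suc c)) (trans (binom-factorial (suc a) c) (cong _! (sym (+-suc a c)))) ⟩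
  suc a * (a + suc c) ! + suc c * (a + suc c) !
    ≡⟨ *-distribʳ-+ ((a + suc c) !) (suc a) (suc c) ⟨
  suc (a + suc c) * (a + suc c) ! ∎
  where
  open ≡-Reasoning
  distribute : ∀ a c g h A C → (g + h) * ((suc a * A) * (suc c * C)) ≡
    suc a * (g * (A * (suc c * C))) + suc c * (h * ((suc a * A) * C))
  distribute = solve-∀

binom-comm : ∀ a c → binom a c ≡ binom c a
binom-comm zero    zero    = refl
binom-comm zero    (suc c) = refl
binom-comm (suc a) zero    = refl
binom-comm (suc a) (suc c) =
  trans (cong₂ _+_ (binom-comm a (suc c)) (binom-comm (suc a) c)) (+-comm (binom (suc c) a) (binom c (suc a)))

binom-absorption : ∀ a c → suc a * binom (suc a) c ≡ suc c * binom a (suc c)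
binom-absorption a c = *-cancelʳ-≡ _ _ (a ! * c !) {{a !* c !≢0}} (begin
  (suc a * binom (suc a) c) * (a ! * c !)   ≡⟨ move-left a (binom (suc a) c) (a !) (c !) ⟩
  binom (suc a) c * ((suc a * a !) * c !)   ≡⟨ binom-factorial (suc a) c ⟩
  (suc a + c) !                             ≡⟨ cong _! (+-suc a c) ⟨
  (a + suc c) !                             ≡⟨ binom-factorial a (suc c) ⟨
  binom a (suc c) * (a ! * (suc c * c !))   ≡⟨ move-right c (binom a (suc c)) (a !) (c !) ⟨
  (suc c * binom a (suc c)) * (a ! * c !)   ∎)
  where
  open ≡-Reasoning
  move-left : ∀ a g A C → (suc a * g) * (A * C) ≡ g * ((suc a * A) * C)
  move-left = solve-∀
  move-right : ∀ c g A C → (suc c * g) * (A * C) ≡ g * (A * (suc c * C))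
  move-right = solve-∀

binom-suc-suc : ∀ a c →
  binom (suc a) (suc c) * (suc a * suc c) ≡ (suc (suc (a + c)) * suc (a + c)) * binom a c
binom-suc-suc a c = *-cancelʳ-≡ _ _ (a ! * c !) {{a !* c !≢0}} (begin
  (binom (suc a) (suc c) * (suc a * suc c)) * (a ! * c !)
    ≡⟨ regroup a c (binom (suc a) (suc c)) (a !) (c !) ⟩
  binom (suc a) (suc c) * ((suc a * a !) * (suc c * c !))
    ≡⟨ binom-factorial (suc a) (suc c) ⟩
  suc (a + suc c) * (a + suc c) !
    ≡⟨ cong (λ k → suc k * k !) (+-suc a c) ⟩
  suc (suc (a + c)) * (suc (a + c) * (a + c) !)
    ≡⟨ cong (λ k → suc (suc (a + c)) * (suc (a + c) * k)) (binom-factorial a c) ⟨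
  suc (suc (a + c)) * (suc (a + c) * (binom a c * (a ! * c !)))
    ≡⟨ *-assoc-4 (suc (suc (a + c))) (suc (a + c)) (binom a c) (a ! * c !) ⟩
  ((suc (suc (a + c)) * suc (a + c)) * binom a c) * (a ! * c !) ∎)
  where
  open ≡-Reasoning
  regroup : ∀ a c g A C → (g * (suc a * suc c)) * (A * C) ≡ g * ((suc a * A) * (suc c * C))
  regroup = solve-∀
  *-assoc-4 : ∀ x y g F → x * (y * (g * F)) ≡ ((x * y) * g) * F
  *-assoc-4 = solve-∀

-- The reflection principle: ballot d (d + 2m + 2) = (d+2m+2 choose m+1) − (d+2m+2 choose m).
evenBallot-reflection : ∀ d m W → d + m ≡ W →
  evenBallot d (suc m) + binom m (suc (suc W)) ≡ binom (suc m) (suc W)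
evenBallot-reflection zero zero .0 refl = refl
evenBallot-reflection zero (suc m) .(suc m) refl = begin
  evenBallot 0 (suc (suc m)) + (binom m (3 + m) + binom (suc m) (2 + m))
    ≡⟨ cong (_+ (binom m (3 + m) + binom (suc m) (2 + m))) (evenBallot-zero-suc (suc m)) ⟩
  evenBallot 1 (suc m) + (binom m (3 + m) + binom (suc m) (2 + m))
    ≡⟨ +-assoc (evenBallot 1 (suc m)) (binom m (3 + m)) _ ⟨
  (evenBallot 1 (suc m) + binom m (3 + m)) + binom (suc m) (2 + m)
    ≡⟨ cong (_+ binom (suc m) (2 + m)) (evenBallot-reflection 1 m (suc m) refl) ⟩
  binom (suc m) (2 + m) + binom (suc m) (2 + m)
    ≡⟨ cong (_+_ (binom (suc m) (2 + m))) (binom-comm (suc m) (2 + m)) ⟩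
  binom (suc m) (2 + m) + binom (2 + m) (suc m) ∎
  where open ≡-Reasoning
evenBallot-reflection (suc d) zero .(suc (d + 0)) refl = begin
  evenBallot (suc d) 1 + 1                      ≡⟨ cong (_+ 1) (evenBallot-suc d 0) ⟩
  (evenBallot d 1 + evenBallot (2 + d) 0) + 1   ≡⟨ cong (λ k → (evenBallot d 1 + k) + 1) (evenBallot-zero (2 + d)) ⟩
  (evenBallot d 1 + 1) + 1                      ≡⟨ +-comm (evenBallot d 1 + 1) 1 ⟩
  1 + (evenBallot d 1 + 1)                      ≡⟨ cong (_+_ 1) (evenBallot-reflection d 0 (d + 0) refl) ⟩
  1 + binom 1 (suc (d + 0))                     ∎
  where open ≡-Reasoning
evenBallot-reflection (suc d) (suc m) .(suc (d + suc m)) refl = begin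
  evenBallot (suc d) (2 + m) + binom (suc m) (3 + W)
    ≡⟨ cong (_+ binom (suc m) (3 + W)) (evenBallot-suc d (suc m)) ⟩
  (evenBallot d (2 + m) + evenBallot (2 + d) (suc m)) + (binom m (3 + W) + binom (suc m) (2 + W))
    ≡⟨ interchange (evenBallot d (2 + m)) (evenBallot (2 + d) (suc m)) (binom m (3 + W)) (binom (suc m) (2 + W)) ⟩
  (evenBallot d (2 + m) + binom (suc m) (2 + W)) + (evenBallot (2 + d) (suc m) + binom m (3 + W))
    ≡⟨ cong₂ _+_ (evenBallot-reflection d (suc m) W refl)
                 (evenBallot-reflection (2 + d) m (suc W) (cong suc (sym (+-suc d m)))) ⟩
  binom (2 + m) (suc W) + binom (suc m) (2 + W)
    ≡⟨ +-comm (binom (2 + m) (suc W)) _ ⟩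
  binom (suc m) (2 + W) + binom (2 + m) (suc W) ∎
  where
  open ≡-Reasoning
  W = d + suc m
  interchange : ∀ a b c e → (a + b) + (c + e) ≡ (a + e) + (b + c)
  interchange = solve-∀

evenBallot-closed : ∀ d m W → d + m ≡ W → evenBallot d m * suc W ≡ suc d * binom m W
evenBallot-closed d zero    W refl rewrite evenBallot-zero d =
  trans (*-identityˡ _) (trans (cong suc (+-identityʳ d)) (sym (*-identityʳ (suc d))))
evenBallot-closed d (suc m) W refl rewrite +-suc d m =
  +-cancelʳ-≡ (S * X) (h * S) (suc d * Y) (begin
    h * S + S * X          ≡⟨ cong (_+ S * X) (*-comm h S) ⟩
    S * h + S * X          ≡⟨ *-distribˡ-+ S h X ⟨
    S * (h + X)            ≡⟨ cong (S *_) (evenBallot-reflection d m (d + m) refl) ⟩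
    S * Y                  ≡⟨ *-comm S Y ⟩
    Y * S                  ≡⟨ cong (λ k → Y * suc k) (+-suc d m) ⟨
    Y * (suc d + suc m)    ≡⟨ *-distribˡ-+ Y (suc d) (suc m) ⟩
    Y * suc d + Y * suc m  ≡⟨ cong₂ _+_ (*-comm Y (suc d)) (*-comm Y (suc m)) ⟩
    suc d * Y + suc m * Y  ≡⟨ cong (_+_ (suc d * Y)) (binom-absorption m (suc (d + m))) ⟩
    suc d * Y + S * X      ∎)
  where
  open ≡-Reasoning
  S = suc (suc (d + m))
  h = evenBallot d (suc m)
  X = binom m (suc (suc (d + m)))
  Y = binom (suc m) (suc (d + m))

-- Growth in time, decay in height

evenBallot-time-ratio : ∀ n m →
  evenBallot n (suc m) * (suc (suc (n + m)) * suc m) ≡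
  (suc (suc (m + (n + m))) * suc (m + (n + m))) * evenBallot n m
evenBallot-time-ratio n m = *-cancelʳ-≡ (evenBallot n (suc m) * (S * suc m)) (P * evenBallot n m) (suc (n + m)) (begin
  evenBallot n (suc m) * (S * suc m) * suc (n + m)
    ≡⟨ regroup (evenBallot n (suc m)) S (suc m) (suc (n + m)) ⟩
  (evenBallot n (suc m) * S) * (suc m * suc (n + m))
    ≡⟨ cong (_* (suc m * suc (n + m))) (evenBallot-closed n (suc m) (suc (n + m)) (+-suc n m)) ⟩
  (suc n * binom (suc m) (suc (n + m))) * (suc m * suc (n + m))
    ≡⟨ *-assoc (suc n) (binom (suc m) (suc (n + m))) (suc m * suc (n + m)) ⟩
  suc n * (binom (suc m) (suc (n + m)) * (suc m * suc (n + m)))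
    ≡⟨ cong (suc n *_) (binom-suc-suc m (n + m)) ⟩
  suc n * (P * binom m (n + m))
    ≡⟨ *-left-comm (suc n) P (binom m (n + m)) ⟩
  P * (suc n * binom m (n + m))
    ≡⟨ cong (P *_) (evenBallot-closed n m (n + m) refl) ⟨
  P * (evenBallot n m * suc (n + m))
    ≡⟨ *-assoc P (evenBallot n m) (suc (n + m)) ⟨
  P * evenBallot n m * suc (n + m) ∎)
  where
  open ≡-Reasoning
  S = suc (suc (n + m))
  P = suc (suc (m + (n + m))) * suc (m + (n + m))
  regroup : ∀ a b c d → a * (b * c) * d ≡ (a * b) * (c * d)
  regroup = solve-∀
  *-left-comm : ∀ a b c → a * (b * c) ≡ b * (a * c)
  *-left-comm = solve-∀

evenBallot-time-growth : ∀ n m → 3 * ((n + (m + m)) + 2) ≤ n * n + 2 * n →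
  evenBallot n m * 4 ≤ evenBallot n (suc m)
evenBallot-time-growth n m bound = *-cancelʳ-≤ _ _ Q (begin
  evenBallot n m * 4 * Q    ≡⟨ *-assoc (evenBallot n m) 4 Q ⟩
  evenBallot n m * (4 * Q)  ≤⟨ *-monoʳ-≤ (evenBallot n m) 4Q≤P ⟩
  evenBallot n m * P        ≡⟨ *-comm (evenBallot n m) P ⟩
  P * evenBallot n m        ≡⟨ evenBallot-time-ratio n m ⟨
  evenBallot n (suc m) * Q  ∎)
  where
  open ≤-Reasoning
  Q = suc (suc (n + m)) * suc m
  P = suc (suc (m + (n + m))) * suc (m + (n + m))
  difference : ∀ n m → suc (suc (m + (n + m))) * suc (m + (n + m)) + 3 * ((n + (m + m)) + 2) ≡
                       4 * (suc (suc (n + m)) * suc m) + (n * n + 2 * n)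
  difference = solve-∀
  4Q≤P : 4 * Q ≤ P
  4Q≤P = +-cancelʳ-≤ (3 * ((n + (m + m)) + 2)) (4 * Q) P
           (≤-trans (+-monoʳ-≤ (4 * Q) bound) (≤-reflexive (sym (difference n m))))

ballot-time-growth : ∀ n s → 3 * (s + 2) ≤ n * n + 2 * n → ballot n s * 4 ≤ ballot n (2 + s)
ballot-time-growth n s bound with ballot≡0⊎even n s
... | inj₁ ballot≡0 rewrite ballot≡0 = z≤n
... | inj₂ (m , refl) =
  subst (λ k → evenBallot n m * 4 ≤ ballot n k) (index n m) (evenBallot-time-growth n m bound)
  where
  index : ∀ n m → n + (suc m + suc m) ≡ 2 + (n + (m + m))
  index = solve-∀

ballot-time-growth-iter : ∀ n s q → 3 * (s + (q + q)) ≤ n * n + 2 * n →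
  ballot n s * 2 ^ (q + q) ≤ ballot n (s + (q + q))
ballot-time-growth-iter n s zero _
  rewrite *-identityʳ (ballot n s) | +-identityʳ s = ≤-refl
ballot-time-growth-iter n s (suc q) bound = begin
  ballot n s * 2 ^ (suc q + suc q)       ≡⟨ cong (ballot n s *_) (powers q) ⟩
  ballot n s * (2 ^ (q + q) * 4)         ≡⟨ *-assoc (ballot n s) (2 ^ (q + q)) 4 ⟨
  ballot n s * 2 ^ (q + q) * 4           ≤⟨ *-monoˡ-≤ 4 (ballot-time-growth-iter n s q (≤-trans (*-monoʳ-≤ 3 (m≤m+n (s + (q + q)) 2)) bound′)) ⟩
  ballot n (s + (q + q)) * 4             ≤⟨ ballot-time-growth n (s + (q + q)) bound′ ⟩
  ballot n (2 + (s + (q + q)))           ≡⟨ cong (ballot n) (index s q) ⟨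
  ballot n (s + (suc q + suc q))         ∎
  where
  open ≤-Reasoning
  index : ∀ s q → s + (suc q + suc q) ≡ 2 + (s + (q + q))
  index = solve-∀
  bound′ : 3 * (s + (q + q) + 2) ≤ n * n + 2 * n
  bound′ = subst (λ k → 3 * k ≤ n * n + 2 * n) (trans (index s q) (+-comm 2 _)) bound
  powers : ∀ q → 2 ^ (suc q + suc q) ≡ 2 ^ (q + q) * 4
  powers q = trans (cong (λ k → 2 ^ suc k) (+-suc q q)) (shuffle (2 ^ (q + q)))
    where
    shuffle : ∀ a → 2 * (2 * a) ≡ a * 4
    shuffle = solve-∀

evenBallot-space-ratio : ∀ e m →
  evenBallot (2 + e) m * ((3 + (e + m)) * suc e) ≡ evenBallot e (suc m) * ((3 + e) * suc m)
evenBallot-space-ratio e m = begin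
  evenBallot (2 + e) m * ((3 + (e + m)) * suc e)   ≡⟨ *-assoc (evenBallot (2 + e) m) (3 + (e + m)) (suc e) ⟨
  evenBallot (2 + e) m * (3 + (e + m)) * suc e     ≡⟨ cong (_* suc e) (evenBallot-closed (2 + e) m (2 + (e + m)) refl) ⟩
  (3 + e) * g * suc e                              ≡⟨ *-assoc (3 + e) g (suc e) ⟩
  (3 + e) * (g * suc e)                            ≡⟨ cong (_*_ (3 + e)) (trans (*-comm g (suc e)) (sym low)) ⟩
  (3 + e) * (evenBallot e (suc m) * suc m)         ≡⟨ *-left-comm (3 + e) (evenBallot e (suc m)) (suc m) ⟩
  evenBallot e (suc m) * ((3 + e) * suc m)         ∎
  where
  open ≡-Reasoning
  g = binom m (2 + (e + m))
  *-left-comm : ∀ a b c → a * (b * c) ≡ b * (a * c)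
  *-left-comm = solve-∀
  low : evenBallot e (suc m) * suc m ≡ suc e * g
  low = *-cancelʳ-≡ (evenBallot e (suc m) * suc m) (suc e * g) (2 + (e + m)) (begin
    evenBallot e (suc m) * suc m * (2 + (e + m))
      ≡⟨ swap (evenBallot e (suc m)) (suc m) (2 + (e + m)) ⟩
    evenBallot e (suc m) * (2 + (e + m)) * suc m
      ≡⟨ cong (_* suc m) (evenBallot-closed e (suc m) (suc (e + m)) (+-suc e m)) ⟩
    suc e * binom (suc m) (suc (e + m)) * suc m
      ≡⟨ *-assoc (suc e) (binom (suc m) (suc (e + m))) (suc m) ⟩
    suc e * (binom (suc m) (suc (e + m)) * suc m)
      ≡⟨ cong (_*_ (suc e)) (trans (*-comm (binom (suc m) (suc (e + m))) (suc m)) (binom-absorption m (suc (e + m)))) ⟩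
    suc e * ((2 + (e + m)) * g)
      ≡⟨ cong (_*_ (suc e)) (*-comm (2 + (e + m)) g) ⟩
    suc e * (g * (2 + (e + m)))
      ≡⟨ *-assoc (suc e) g (2 + (e + m)) ⟨
    suc e * g * (2 + (e + m)) ∎)
    where
    swap : ∀ a b c → a * b * c ≡ a * c * b
    swap = solve-∀

evenBallot-space-antitone : ∀ e m → m + m ≤ e * e + 3 * e → evenBallot (2 + e) m ≤ evenBallot e (suc m)
evenBallot-space-antitone e m bound = *-cancelʳ-≤ _ _ X (begin
  evenBallot (2 + e) m * X      ≡⟨ evenBallot-space-ratio e m ⟩
  evenBallot e (suc m) * Y      ≤⟨ *-monoʳ-≤ (evenBallot e (suc m)) Y≤X ⟩
  evenBallot e (suc m) * X      ∎)
  where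
  open ≤-Reasoning
  X = (3 + (e + m)) * suc e
  Y = (3 + e) * suc m
  difference : ∀ e m → (3 + (e + m)) * suc e + (m + m) ≡ (3 + e) * suc m + (e * e + 3 * e)
  difference = solve-∀
  Y≤X : Y ≤ X
  Y≤X = +-cancelʳ-≤ (m + m) Y X (≤-trans (+-monoʳ-≤ Y bound) (≤-reflexive (sym (difference e m))))

ballot-space-antitone : ∀ e u → u ≤ e * e + 4 * e + 2 → ballot (2 + e) u ≤ ballot e u
ballot-space-antitone e u bound with ballot≡0⊎even (2 + e) u
... | inj₁ ballot≡0 rewrite ballot≡0 = z≤n
... | inj₂ (m , refl) =
  subst (λ k → evenBallot (2 + e) m ≤ ballot e k) (index e m)
    (evenBallot-space-antitone e m (+-cancelʳ-≤ (e + 2) (m + m) (e * e + 3 * e)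
      (subst₂ _≤_ (bound-index e m) (poly e) bound)))
  where
  index : ∀ e m → e + (suc m + suc m) ≡ (2 + e) + (m + m)
  index = solve-∀
  bound-index : ∀ e m → (2 + e) + (m + m) ≡ (m + m) + (e + 2)
  bound-index = solve-∀
  poly : ∀ e → e * e + 4 * e + 2 ≡ (e * e + 3 * e) + (e + 2)
  poly = solve-∀

ballot-space-decay : ∀ k e v → v + k ≤ e * e + 4 * e + 2 →
  2 ^ k * ballot (suc e + k) v ≤ ballot (suc e) (v + k)
ballot-space-decay zero e v _
  rewrite +-identityʳ (suc e) | +-identityʳ v | *-identityˡ (ballot (suc e) v) = ≤-refl
ballot-space-decay (suc k) e v bound = begin
  2 ^ suc k * ballot (suc e + suc k) v
    ≡⟨ cong (λ d → 2 ^ suc k * ballot d v) (+-suc (suc e) k) ⟩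
  (2 * 2 ^ k) * ballot (2 + e + k) v
    ≡⟨ double (2 ^ k) (ballot (2 + e + k) v) ⟩
  2 ^ k * ballot (2 + e + k) v + 2 ^ k * ballot (2 + e + k) v
    ≤⟨ +-mono-≤ ih ih ⟩
  ballot (2 + e) (v + k) + ballot (2 + e) (v + k)
    ≤⟨ +-monoˡ-≤ _ (ballot-space-antitone e (v + k) bound′) ⟩
  ballot e (v + k) + ballot (2 + e) (v + k)
    ≡⟨ cong (ballot (suc e)) (+-suc v k) ⟨
  ballot (suc e) (v + suc k) ∎
  where
  open ≤-Reasoning
  double : ∀ a y → (2 * a) * y ≡ a * y + a * y
  double = solve-∀
  growth : ∀ e → suc e * suc e + 4 * suc e + 2 ≡ (e * e + 4 * e + 2) + (e + e + 5)
  growth = solve-∀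
  bound′ : v + k ≤ e * e + 4 * e + 2
  bound′ = ≤-trans (+-monoʳ-≤ v (n≤1+n k)) bound
  ih = ballot-space-decay k (suc e) v (≤-trans bound′ (≤-trans (m≤m+n _ _) (≤-reflexive (sym (growth e)))))

-- Splitting at the first visit to 0

module _ (n i t A : ℕ)
  (fromZero : ∀ s → s + i ≤ t → count s (hitsTopAtEnd (+ 0) n) * 2 ^ t ≤ A * 2 ^ s) where

  -- A walk started at i that is at k with s steps left has already used at least i ∸ k steps,
  -- hence the invariant s + i ≤ t + k; on reaching 0 it becomes the hypothesis of fromZero.
  hitsTopAfterBelow1-bound : ∀ s k → 1 ≤ k → s + i ≤ t + k →
    count s (hitsTopAfterBelow1 (+ k) n) * 2 ^ t ≤ A * count s (goesBelow1 (+ k))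
  hitsTopAfterBelow1-bound zero k 1≤k _
    rewrite count-hitsTopAfterBelow1-zero n (+ k) (+≤+ 1≤k) = z≤n
  hitsTopAfterBelow1-bound (suc s) (suc k) 1≤k s+i≤t+k with suc k ℕ.≤? n
  ... | no k≰n rewrite count-hitsTopAfterBelow1-above n (+ suc k) (suc s) (+<+ (≰⇒> k≰n)) = z≤n
  ... | yes k≤n
    rewrite count-hitsTopAfterBelow1-suc n (+ suc k) s (+≤+ 1≤k) (+≤+ k≤n)
          | count-goesBelow1-suc (+ suc k) s (+≤+ 1≤k)
          | *-distribʳ-+ (2 ^ t) (count s (hitsTopAfterBelow1 (+ (suc k + 1)) n)) (count s (hitsTopAfterBelow1 (+ k) n))
          | *-distribˡ-+ A (count s (goesBelow1 (+ (suc k + 1)))) (count s (goesBelow1 (+ k)))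
    = +-mono-≤ up (down k (≤-trans s+i≤t+k (≤-reflexive (+-suc t k))))
    where
    up : count s (hitsTopAfterBelow1 (+ (suc k + 1)) n) * 2 ^ t ≤ A * count s (goesBelow1 (+ (suc k + 1)))
    up = hitsTopAfterBelow1-bound s (suc k + 1) (s≤s z≤n)
           (≤-trans (n≤1+n (s + i)) (≤-trans s+i≤t+k (+-monoʳ-≤ t (m≤m+n (suc k) 1))))
    down : ∀ k → suc s + i ≤ suc (t + k) →
      count s (hitsTopAfterBelow1 (+ k) n) * 2 ^ t ≤ A * count s (goesBelow1 (+ k))
    down zero s+i≤t
      rewrite count-hitsTopAfterBelow1-below n (+ 0) s (+<+ (s≤s z≤n))
            | count-goesBelow1-below (+ 0) s (+<+ (s≤s z≤n)) =
      fromZero s (≤-pred (≤-trans s+i≤t (≤-reflexive (cong suc (+-identityʳ t)))))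
    down (suc k) s+i≤t+k = hitsTopAfterBelow1-bound s (suc k) (s≤s z≤n) (≤-pred s+i≤t+k)

ballot-descent-bound-even : ∀ e i s q → i ≤ 2 + e → 4 * (s + i + (q + q)) ≤ (suc e + i) * (suc e + i) →
  ballot (suc e + i) s * 2 ^ (s + i + (q + q)) ≤ ballot (suc e) (s + i + (q + q)) * 2 ^ s
ballot-descent-bound-even e i s q i≤2+e 4t≤n² = begin
  ballot n s * 2 ^ t                      ≡⟨ cong (ballot n s *_) (powers s i (q + q)) ⟩
  ballot n s * ((2 ^ s * 2 ^ i) * 2 ^ (q + q))
    ≡⟨ regroup (ballot n s) (2 ^ s) (2 ^ i) (2 ^ (q + q)) ⟩
  (2 ^ i * (ballot n s * 2 ^ (q + q))) * 2 ^ s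
    ≤⟨ *-monoˡ-≤ (2 ^ s) (*-monoʳ-≤ (2 ^ i) (ballot-time-growth-iter n s q time-bound)) ⟩
  (2 ^ i * ballot n v) * 2 ^ s            ≤⟨ *-monoˡ-≤ (2 ^ s) (ballot-space-decay i e v space-bound) ⟩
  ballot (suc e) (v + i) * 2 ^ s          ≡⟨ cong (λ u → ballot (suc e) u * 2 ^ s) (v+i≡t s i q) ⟩
  ballot (suc e) t * 2 ^ s                ∎
  where
  open ≤-Reasoning
  n = suc e + i
  t = s + i + (q + q)
  v = s + (q + q)
  v+i≡t : ∀ s i q → s + (q + q) + i ≡ s + i + (q + q)
  v+i≡t = solve-∀
  powers : ∀ s i r → 2 ^ (s + i + r) ≡ (2 ^ s * 2 ^ i) * 2 ^ r
  powers s i r = trans (^-distribˡ-+-* 2 (s + i) r) (cong (_* 2 ^ r) (^-distribˡ-+-* 2 s i))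
  regroup : ∀ h a b c → h * ((a * b) * c) ≡ (b * (h * c)) * a
  regroup = solve-∀
  time-bound : 3 * v ≤ n * n + 2 * n
  time-bound = begin
    3 * v  ≤⟨ *-monoʳ-≤ 3 (≤-trans (m≤m+n v i) (≤-reflexive (v+i≡t s i q))) ⟩
    3 * t  ≤⟨ *-monoˡ-≤ t (n≤1+n 3) ⟩
    4 * t  ≤⟨ 4t≤n² ⟩
    n * n  ≤⟨ m≤m+n (n * n) (2 * n) ⟩
    n * n + 2 * n ∎
  n≤2e+3 : n ≤ e + e + 3
  n≤2e+3 = ≤-trans (+-monoʳ-≤ (suc e) i≤2+e) (≤-reflexive (shuffle e))
    where
    shuffle : ∀ e → suc e + (2 + e) ≡ e + e + 3
    shuffle = solve-∀
  space-bound : v + i ≤ e * e + 4 * e + 2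
  space-bound = ≤-trans (≤-reflexive (v+i≡t s i q)) (≤-pred (*-cancelˡ-< 4 t (suc (e * e + 4 * e + 2)) (begin-strict
    4 * t                          ≤⟨ 4t≤n² ⟩
    n * n                          ≤⟨ *-mono-≤ n≤2e+3 n≤2e+3 ⟩
    (e + e + 3) * (e + e + 3)      <⟨ m<m+n _ (s≤s z≤n) ⟩
    (e + e + 3) * (e + e + 3) + suc (4 * e + 2) ≡⟨ square e ⟩
    4 * suc (e * e + 4 * e + 2)    ∎)))
    where
    square : ∀ e → (e + e + 3) * (e + e + 3) + suc (4 * e + 2) ≡ 4 * suc (e * e + 4 * e + 2)
    square = solve-∀

suc-%2≢%2 : ∀ a → suc a % 2 ≢ a % 2
suc-%2≢%2 zero          ()
suc-%2≢%2 (suc zero)    ()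
suc-%2≢%2 (suc (suc a)) = suc-%2≢%2 a

even-of-%2 : ∀ a r → (a + r) % 2 ≡ a % 2 → ∃ λ q → r ≡ q + q
even-of-%2 a r a+r≡a with half r
... | q , inj₁ r≡2q   = q , r≡2q
... | q , inj₂ refl = ⊥-elim (suc-%2≢%2 a (begin
  suc a % 2             ≡⟨ [m+kn]%n≡m%n (suc a) q 2 ⟨
  (suc a + q * 2) % 2   ≡⟨ cong (_% 2) (shuffle a q) ⟩
  (a + suc (q + q)) % 2 ≡⟨ a+r≡a ⟩
  a % 2                 ∎))
  where
  open ≡-Reasoning
  shuffle : ∀ a q → suc a + q * 2 ≡ a + suc (q + q)
  shuffle = solve-∀

start-below-top : ∀ n i t → 1 ≤ i → i + i ≤ suc n → 4 * t ≤ n * n → n + i ≤ t →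
  ∃ λ e → suc e + i ≡ n
start-below-top n i t 1≤i 2i≤1+n 4t≤n² n+i≤t with suc i ℕ.≤? n
... | yes i<n = n ∸ suc i , trans (cong suc (+-comm (n ∸ suc i) i)) (m+[n∸m]≡n i<n)
... | no  i≮n = ⊥-elim (4≰1 (begin
  4 * 1   ≤⟨ *-monoʳ-≤ 4 (≤-trans 1≤i (≤-trans (m≤n+m i n) n+i≤t)) ⟩
  4 * t   ≤⟨ 4t≤n² ⟩
  n * n   ≤⟨ *-mono-≤ n≤1 n≤1 ⟩
  1 * 1   ∎))
  where
  open ≤-Reasoning
  4≰1 : ¬ (4 ≤ 1)
  4≰1 (s≤s ())
  n≤i = ≮⇒≥ i≮n
  n≤1 : n ≤ 1
  n≤1 = +-cancelˡ-≤ n n 1 (≤-trans (+-mono-≤ n≤i n≤i) (≤-trans 2i≤1+n (≤-reflexive (+-comm 1 n))))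

%2-gap : ∀ n m i r → (n + (m + m) + i + r + i) % 2 ≡ (n + r) % 2
%2-gap n m i r = trans (cong (_% 2) (regroup n m i r)) ([m+kn]%n≡m%n (n + r) (m + i) 2)
  where
  regroup : ∀ n m i r → n + (m + m) + i + r + i ≡ n + r + (m + i) * 2
  regroup = solve-∀

ballot-descent-bound : ∀ n i t → 1 ≤ i → i + i ≤ suc n → 4 * t ≤ n * n → (t + i) % 2 ≡ n % 2 →
  ∀ s → s + i ≤ t → ballot n s * 2 ^ t ≤ ballot (n ∸ i) t * 2 ^ s
ballot-descent-bound n i t 1≤i 2i≤1+n 4t≤n² parity s s+i≤t with ballot≡0⊎even n s
... | inj₁ ballot≡0 rewrite ballot≡0 = z≤n
... | inj₂ (m , refl) with m≤n⇒∃[o]m+o≡n s+i≤t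
... | r , refl with even-of-%2 n r (trans (sym (%2-gap n m i r)) parity)
                  | start-below-top n i _ 1≤i 2i≤1+n 4t≤n² (≤-trans (+-monoˡ-≤ i (m≤m+n n (m + m))) (m≤m+n _ r))
... | q , refl | e , refl rewrite m+n∸n≡m (suc e) i =
  ballot-descent-bound-even e i (suc e + i + (m + m)) q (+-cancelˡ-≤ i i (2 + e) (≤-trans 2i≤1+n (≤-reflexive (shuffle e i)))) 4t≤n²
  where
  shuffle : ∀ e i → suc (suc e + i) ≡ i + (2 + e)
  shuffle = solve-∀

1≤m⇒m+m≤1+n⇒m≤n : ∀ {m n} → 1 ≤ m → m + m ≤ suc n → m ≤ n
1≤m⇒m+m≤1+n⇒m≤n {m} 1≤m m+m≤1+n = ≤-pred (≤-trans (≤-reflexive (+-comm 1 m)) (≤-trans (+-monoʳ-≤ m 1≤m) m+m≤1+n))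

hitsTopAtEnd-goesBelow1-negativelyCorrelated : ∀ n i t → 1 ≤ i → i + i ≤ suc n → 4 * t ≤ n * n →
  (t + i) % 2 ≡ n % 2 →
  count t (hitsTopAfterBelow1 (+ i) n) * 2 ^ t ≤ count t (hitsTopAtEnd (+ i) n) * count t (goesBelow1 (+ i))
hitsTopAtEnd-goesBelow1-negativelyCorrelated n i t 1≤i 2i≤1+n 4t≤n² parity
  rewrite count-hitsTopAtEnd≡ballot n (n ∸ i) t (+ i) (cong +_ (m+[n∸m]≡n (1≤m⇒m+m≤1+n⇒m≤n 1≤i 2i≤1+n))) =
  hitsTopAfterBelow1-bound n i t (ballot (n ∸ i) t) fromZero t i 1≤i ≤-refl
  where
  fromZero : ∀ s → s + i ≤ t → count s (hitsTopAtEnd (+ 0) n) * 2 ^ t ≤ ballot (n ∸ i) t * 2 ^ s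
  fromZero s s+i≤t rewrite count-hitsTopAtEnd≡ballot n n s (+ 0) (ℤₚ.+-identityˡ (+ n)) =
    ballot-descent-bound n i t 1≤i 2i≤1+n 4t≤n² parity s s+i≤t

⌈n/2⌉+⌈n/2⌉≤1+n : ∀ n → ⌈ n /2⌉ + ⌈ n /2⌉ ≤ suc n
⌈n/2⌉+⌈n/2⌉≤1+n n =
  ≤-trans (+-monoʳ-≤ ⌈ n /2⌉ (⌈n/2⌉-mono (n≤1+n n))) (≤-reflexive (⌊n/2⌋+⌈n/2⌉≡n (suc n)))

-- From counts to probabilities

/-mono-cross : ∀ a b c d .{{_ : ℕ.NonZero c}} .{{_ : ℕ.NonZero d}} →
  a * d ≤ b * c → (+ a) ℚ./ c ℚ.≤ (+ b) ℚ./ d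
/-mono-cross a b (suc c) (suc d) ad≤bc =
  ℚₚ.toℚᵘ-cancel-≤ (ℚᵘₚ.≤-respˡ-≃ (ℚᵘₚ.≃-sym (ℚₚ.toℚᵘ-fromℚᵘ (ℚᵘ.mkℚᵘ (+ a) c)))
                     (ℚᵘₚ.≤-respʳ-≃ (ℚᵘₚ.≃-sym (ℚₚ.toℚᵘ-fromℚᵘ (ℚᵘ.mkℚᵘ (+ b) d)))
                       (ℚᵘ.*≤* (subst₂ ℤ._≤_ (ℤₚ.pos-* a (suc d)) (ℤₚ.pos-* b (suc c)) (+≤+ ad≤bc)))))

-- CondPr t A B is 0 when B is null, so no positivity hypothesis is needed.
CondPr≤Pr : ∀ t A B → count t (λ p → A p ∧ B p) * 2 ^ t ≤ count t A * count t B → CondPr t A B ℚ.≤ Pr t A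
CondPr≤Pr t A B bound with count t B
... | zero  = /-mono-cross 0 (count t A) 1 (2 ^ t) {{_}} {{m^n≢0 2 t}} z≤n
... | suc k = /-mono-cross (count t (λ p → A p ∧ B p)) (count t A) (suc k) (2 ^ t) {{_}} {{m^n≢0 2 t}} bound

mainTheorem9 : (n i t : ℕ) → 1 ≤ n → 1 ≤ i → i ≤ ⌈ n /2⌉ →
    4 * t ≤ n * n → (t + i) % 2 ≡ n % 2 →
    0ℚ < Pr t (goesBelow1 (+ i)) →
    Pr t (hitsTopAtEnd (+ i) n) ≥ CondPr t (hitsTopAtEnd (+ i) n) (goesBelow1 (+ i))
mainTheorem9 n i t _ 1≤i i≤⌈n/2⌉ 4t≤n² parity _ =
  CondPr≤Pr t (hitsTopAtEnd (+ i) n) (goesBelow1 (+ i))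
    (hitsTopAtEnd-goesBelow1-negativelyCorrelated n i t 1≤i 2i≤1+n 4t≤n² parity)
  where
  2i≤1+n : i + i ≤ suc n
  2i≤1+n = ≤-trans (+-mono-≤ i≤⌈n/2⌉ i≤⌈n/2⌉) (⌈n/2⌉+⌈n/2⌉≤1+n n)
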